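{- Let $n,c,s$ be integers with $n,c\ge2$, $s\in[c-1]$, and $c\mid n$. Let $t=sn/c$ and $s_0=\min\{s,c-s\}$. Then \[m(n,t,s_0+1;s+1,c-s+1)=\frac{s_0}{c}\binom{n}{t},\qquad m(n,t,c-s_0+1;s+1,c-s+1)=\frac{c-s_0}{c}\binom{n}{t}.\]
   Context: $[m]=\{1,\dots,m\}$. A sequence $A_1,\dots,A_\lambda$ of subsets of $[n]$ (repetitions allowed) is $(k_1,k_2)$-disjoint if $\bigcap_{i\in B}A_i=\emptyset$ for every $k_1$-subset $B\subseteq[\lambda]$ and $\bigcup_{i\in B}A_i=[n]$ for every $k_2$-subset $B\subseteq[\lambda]$ (each condition vacuous if the subset size exceeds $\lambda$). $m(n,t,\lambda;k_1,k_2)$ is the maximum size of a family $\mathcal{F}$ of $t$-subsets of $[n]$ such that no $A_1,\dots,A_\lambda\in\mathcal{F}$ (not necessarily distinct) form a $(k_1,k_2)$-disjoint sequence. -}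

module Defs where

open import Data.Nat using (ℕ; _≤_)
open import Data.Fin using (Fin)
open import Data.Fin.Subset using (Subset; ∣_∣; _∈_; _∉_)
open import Data.List using (List; length)
open import Data.List.Relation.Unary.All using (All)
open import Data.List.Relation.Unary.Unique.Propositional using (Unique)
import Data.List.Membership.Propositional as LM
open import Data.Product using (Σ; ∃; _×_)
open import Relation.Nullary using (¬_)
open import Relation.Binary.PropositionalEquality using (_≡_)

-- Subsets of [n] are `Subset n` (characteristic vectors over Fin n).
-- A sequence A_1..A_λ of subsets of [n] is a function Fin l → Subset n.

IntersectionEmpty : ∀ {n l} → (Fin l → Subset n) → Subset l → Set
IntersectionEmpty {n} A B = (x : Fin n) → ∃ λ i → i ∈ B × x ∉ A i

UnionFull : ∀ {n l} → (Fin l → Subset n) → Subset l → Set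
UnionFull {n} A B = (x : Fin n) → ∃ λ i → i ∈ B × x ∈ A i

-- (k₁,k₂)-disjoint sequence (conditions vacuous when kᵢ > λ since then
-- there are no kᵢ-subsets of [λ]).
Disjoint : ∀ {n l} → ℕ → ℕ → (Fin l → Subset n) → Set
Disjoint {n} {l} k₁ k₂ A =
  ((B : Subset l) → ∣ B ∣ ≡ k₁ → IntersectionEmpty A B) ×
  ((B : Subset l) → ∣ B ∣ ≡ k₂ → UnionFull A B)

-- F is a family (set, no repetitions) of t-subsets of [n] containing no
-- (k₁,k₂)-disjoint sequence of length l (entries not necessarily distinct).
Admissible : (n t l k₁ k₂ : ℕ) → List (Subset n) → Set
Admissible n t l k₁ k₂ F =
  Unique F × All (λ A → ∣ A ∣ ≡ t) F ×
  ¬ (Σ (Fin l → Subset n) λ A → ((i : Fin l) → A i LM.∈ F) × Disjoint k₁ k₂ A)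

IsM : (n t l k₁ k₂ m : ℕ) → Set
IsM n t l k₁ k₂ m =
  (∃ λ F → Admissible n t l k₁ k₂ F × length F ≡ m) ×
  ((F : List (Subset n)) → Admissible n t l k₁ k₂ F → length F ≤ m)

-- Upper bound: average over balanced colourings g : [n] → [c], each colour used d = n / c times.
-- For the c cyclic windows W_j of s consecutive colours (mod c) the sets χ_j g = g⁻¹(W_j) have size t,
-- and every point lies in exactly s of the c sets χ_j g. Hence any s+1 of them have empty
-- intersection and any c−s+1 of them cover [n], so a family F admissible for λ = l+1 contains
-- at most l of them. The number of pairs (g, j) with χ_j g = A is a product of two multinomial
-- coefficients depending only on |A|, and double counting gives c·|F| ≤ l·C(n,t).
-- Lower bound: for λ = s+1 the t-sets through a fixed point (any s+1 of them meet), and for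
-- λ = c−s+1 the t-sets avoiding it (no c−s+1 of them cover it), attain this bound.

module Submission where

open import Defs
open import Data.Nat using (ℕ; suc; _+_; _*_; _∸_; _⊓_; _≤_; _<_)
open import Data.Nat.Combinatorics using (_C_)
open import Data.Product using (∃; _×_)
open import Relation.Binary.PropositionalEquality using (_≡_)

open import Data.Nat as ℕ using (zero; z≤n; s≤s; _<ᵇ_; NonZero; ≢-nonZero; >-nonZero⁻¹)
open import Data.Nat.Properties
open import Data.Nat.DivMod using (_%_; _/_; m<n⇒m%n≡m; n%n≡0; [m+kn]%n≡m%n; m≡m%n+[m/n]*n)
open import Data.Nat.Combinatorics using (k>n⇒nCk≡0; nC1≡n; nCk+nC[k+1]≡[n+1]C[k+1])
open import Algebra.Properties.CommutativeSemigroup +-commutativeSemigroup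
  using () renaming (xy∙z≈xz∙y to +-xy∙z≈xz∙y; x∙yz≈y∙xz to +-x∙yz≈y∙xz)
open import Algebra.Properties.CommutativeSemigroup *-commutativeSemigroup
  using () renaming (x∙yz≈y∙xz to *-x∙yz≈y∙xz; xy∙z≈xz∙y to *-xy∙z≈xz∙y)
open import Algebra.Properties.Semiring.Sum +-*-semiring
  using (sum; sum-syntax; sum-cong-≗; sum-init-last; sum-remove; ∑-distrib-+; ∑-comm; *-distribˡ-sum; *-distribʳ-sum)
import Data.Bool as Bool
open import Data.Bool using (Bool; true; false; not; if_then_else_)
open import Data.Bool.Properties using (not-involutive)
open import Data.Fin using (Fin; zero; suc; toℕ; punchOut; inject₁; fromℕ)
import Data.Fin.Properties as Finₚ
open Finₚ using (¬∀⟶∃¬)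
open import Data.Fin.Subset using (Subset; ∣_∣; ∁; ⊤; _∈_; _∉_)
open import Data.Fin.Subset.Properties using (_∈?_; x∉∁p⇒x∈p; ∣⊤∣≡n; ∣∁p∣≡n∸∣p∣)
import Data.Vec as Vec
open import Data.Vec using (Vec; []; _∷_; lookup; map; replicate; updateAt)
open import Data.Vec.Base using (here; there)
open import Data.Vec.Properties using (≡-dec; ∷-injective; ∷-injectiveʳ; []=⇒lookup; lookup-map; map-∘)
open import Data.Vec.Functional using (removeAt)
import Data.List as List
open import Data.List using (List; []; _∷_; length)
open import Data.List.Properties using (length-map; length-++)
import Data.List.Relation.Unary.All as All
open import Data.List.Relation.Unary.All using (All)
import Data.List.Relation.Unary.All.Properties as Allₚ
import Data.List.Relation.Unary.AllPairs as AllPairs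
open import Data.List.Relation.Unary.Any using (here)
open import Data.List.Relation.Unary.Unique.Propositional using (Unique)
import Data.List.Relation.Unary.Unique.Propositional.Properties as Uniqueₚ
open import Data.List.Membership.Propositional using () renaming (_∈_ to _∈ᴸ_; _∉_ to _∉ᴸ_)
open import Data.List.Membership.Propositional.Properties using (∈-map⁺; ∈-map⁻; ∈-++⁺ˡ; ∈-++⁺ʳ)
import Data.List.Membership.DecPropositional as Membershipᴰ
open import Data.Product using (_,_; proj₁; proj₂)
open import Data.Empty using (⊥; ⊥-elim)
open import Function using (_∘_; _⇔_; mk⇔; Injective; Equivalence)
open import Relation.Nullary using (Dec; yes; no; ¬_; does; contradiction)
open import Relation.Nullary.Decidable using (_×-dec_; _→-dec_)
open import Relation.Binary.PropositionalEquality
  using (_≢_; refl; sym; trans; cong; cong₂; subst; module ≡-Reasoning)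

variable
  c l n : ℕ

𝕀 : Bool → ℕ
𝕀 true = 1
𝕀 false = 0

𝟙 : ∀ {P : Set} → Dec P → ℕ
𝟙 d = 𝕀 (does d)

𝟙-yes : ∀ {P : Set} → P → (d : Dec P) → 𝟙 d ≡ 1
𝟙-yes p (yes _) = refl
𝟙-yes p (no ¬p) = ⊥-elim (¬p p)

𝟙-no : ∀ {P : Set} → ¬ P → (d : Dec P) → 𝟙 d ≡ 0
𝟙-no ¬p (yes p) = ⊥-elim (¬p p)
𝟙-no ¬p (no _) = refl

𝟙-cong : ∀ {P Q : Set} → P ⇔ Q → (d : Dec P) (e : Dec Q) → 𝟙 d ≡ 𝟙 e
𝟙-cong P⇔Q (yes p) e = sym (𝟙-yes (Equivalence.to P⇔Q p) e)
𝟙-cong P⇔Q (no ¬p) e = sym (𝟙-no (¬p ∘ Equivalence.from P⇔Q) e)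

𝟙-× : ∀ {P Q : Set} (d : Dec P) (e : Dec Q) → 𝟙 (d ×-dec e) ≡ 𝟙 d * 𝟙 e
𝟙-× (yes _) (yes _) = refl
𝟙-× (yes _) (no _) = refl
𝟙-× (no _) _ = refl

𝟙-≟true : ∀ b → 𝟙 (b Bool.≟ true) ≡ 𝕀 b
𝟙-≟true true = refl
𝟙-≟true false = refl

𝟙-≟false : ∀ b → 𝟙 (b Bool.≟ false) ≡ 𝕀 (not b)
𝟙-≟false true = refl
𝟙-≟false false = refl

∑-const : ∀ n k → ∑[ i < n ] k ≡ n * k
∑-const zero k = refl
∑-const (suc n) k = cong (k +_) (∑-const n k)

∑-mono-≤ : ∀ {f g : Fin n → ℕ} → (∀ i → f i ≤ g i) → sum f ≤ sum g
∑-mono-≤ {zero} f≤g = z≤n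
∑-mono-≤ {suc n} {f} {g} f≤g = +-mono-≤ (f≤g zero) (∑-mono-≤ {f = f ∘ suc} {g ∘ suc} (f≤g ∘ suc))

∑-term-≤ : ∀ (f : Fin n → ℕ) i → f i ≤ sum f
∑-term-≤ {suc n} f i = ≤-trans (m≤m+n (f i) _) (≤-reflexive (sym (sum-remove {i = i} f)))

∑-injective-≤ : (ι : Fin l → Fin c) → Injective _≡_ _≡_ ι → (h : Fin c → ℕ) →
  ∑[ i < l ] h (ι i) ≤ ∑[ j < c ] h j
∑-injective-≤ {zero} ι inj h = z≤n
∑-injective-≤ {suc l} {zero} ι inj h with ι zero
... | ()
∑-injective-≤ {suc l} {suc c} ι inj h = begin
    h (ι zero) + ∑[ i < l ] h (ι (suc i))
  ≡⟨ cong (h (ι zero) +_) (sum-cong-≗ λ i → cong h (sym (Finₚ.punchIn-punchOut (ι₀≢ i)))) ⟩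
    h (ι zero) + ∑[ i < l ] removeAt h (ι zero) (ι′ i)
  ≤⟨ +-monoʳ-≤ (h (ι zero)) (∑-injective-≤ ι′ ι′-injective (removeAt h (ι zero))) ⟩
    h (ι zero) + sum (removeAt h (ι zero))
  ≡⟨ sym (sum-remove h) ⟩
    ∑[ j < suc c ] h j
  ∎
  where
    open ≤-Reasoning
    ι₀≢ : ∀ i → ι zero ≢ ι (suc i)
    ι₀≢ i e = Finₚ.0≢1+n (inj e)
    ι′ : Fin l → Fin c
    ι′ i = punchOut (ι₀≢ i)
    ι′-injective : Injective _≡_ _≡_ ι′
    ι′-injective e = Finₚ.suc-injective (inj (Finₚ.punchOut-injective (ι₀≢ _) (ι₀≢ _) e))

injection-from-∑ : ∀ {P : Fin c → Set} (P? : ∀ j → Dec (P j)) → l ≤ ∑[ j < c ] 𝟙 (P? j) →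
  ∃ λ (ι : Fin l → Fin c) → Injective _≡_ _≡_ ι × (∀ i → P (ι i))
injection-from-∑ {l = zero} P? _ = (λ ()) , (λ { {()} }) , (λ ())
injection-from-∑ {zero} {suc l} P? ()
injection-from-∑ {suc c} {suc l} {P} P? l≤ = extend (P? zero) l≤
  where
    extend : (d : Dec (P zero)) → suc l ≤ 𝟙 d + ∑[ j < c ] 𝟙 (P? (suc j)) →
      ∃ λ (ι : Fin (suc l) → Fin (suc c)) → Injective _≡_ _≡_ ι × (∀ i → P (ι i))
    extend (no _) l≤ with injection-from-∑ (P? ∘ suc) l≤
    ... | ι , ι-inj , ok = suc ∘ ι , ι-inj ∘ Finₚ.suc-injective , ok
    extend (yes p) l≤ with injection-from-∑ (P? ∘ suc) (ℕ.s≤s⁻¹ l≤)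
    ... | ι , ι-inj , ok = ι⁺ , ι⁺-inj , ok⁺
      where
        ι⁺ : Fin (suc l) → Fin (suc c)
        ι⁺ zero = zero
        ι⁺ (suc i) = suc (ι i)
        ι⁺-inj : Injective _≡_ _≡_ ι⁺
        ι⁺-inj {zero} {zero} _ = refl
        ι⁺-inj {suc i} {suc i′} e = cong suc (ι-inj (Finₚ.suc-injective e))
        ok⁺ : ∀ i → P (ι⁺ i)
        ok⁺ zero = p
        ok⁺ (suc i) = ok i

∑-𝕀+∑-𝕀-not : ∀ (f : Fin c → Bool) → ∑[ j < c ] 𝕀 (f j) + ∑[ j < c ] 𝕀 (not (f j)) ≡ c
∑-𝕀+∑-𝕀-not {c} f = begin
    ∑[ j < c ] 𝕀 (f j) + ∑[ j < c ] 𝕀 (not (f j))   ≡⟨ sym (∑-distrib-+ (𝕀 ∘ f) (𝕀 ∘ not ∘ f)) ⟩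
    ∑[ j < c ] (𝕀 (f j) + 𝕀 (not (f j)))            ≡⟨ sum-cong-≗ (𝕀+𝕀-not ∘ f) ⟩
    ∑[ j < c ] 1                                     ≡⟨ trans (∑-const c 1) (*-identityʳ c) ⟩
    c                                                ∎
  where
    open ≡-Reasoning
    𝕀+𝕀-not : ∀ b → 𝕀 b + 𝕀 (not b) ≡ 1
    𝕀+𝕀-not true = refl
    𝕀+𝕀-not false = refl

-- Words over Fin c, counted by content

∑ʷ : ∀ n → (Vec (Fin c) n → ℕ) → ℕ
∑ʷ zero f = f []
∑ʷ {c} (suc n) f = ∑[ v < c ] ∑ʷ n (λ g → f (v ∷ g))

∑ʷ-cong : ∀ n {f h : Vec (Fin c) n → ℕ} → (∀ g → f g ≡ h g) → ∑ʷ n f ≡ ∑ʷ n h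
∑ʷ-cong zero f≗h = f≗h []
∑ʷ-cong (suc n) f≗h = sum-cong-≗ λ v → ∑ʷ-cong n (f≗h ∘ (v ∷_))

∑ʷ-distrib-+ : ∀ n (f h : Vec (Fin c) n → ℕ) → ∑ʷ n (λ g → f g + h g) ≡ ∑ʷ n f + ∑ʷ n h
∑ʷ-distrib-+ zero f h = refl
∑ʷ-distrib-+ (suc n) f h =
  trans (sum-cong-≗ λ v → ∑ʷ-distrib-+ n (f ∘ (v ∷_)) (h ∘ (v ∷_)))
        (∑-distrib-+ (λ v → ∑ʷ n (f ∘ (v ∷_))) (λ v → ∑ʷ n (h ∘ (v ∷_))))

*-distribˡ-∑ʷ : ∀ n k (f : Vec (Fin c) n → ℕ) → k * ∑ʷ n f ≡ ∑ʷ n (λ g → k * f g)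
*-distribˡ-∑ʷ zero k f = refl
*-distribˡ-∑ʷ (suc n) k f =
  trans (*-distribˡ-sum k (λ v → ∑ʷ n (f ∘ (v ∷_)))) (sum-cong-≗ λ v → *-distribˡ-∑ʷ n k (f ∘ (v ∷_)))

∑ʷ-mono-≤ : ∀ n {f h : Vec (Fin c) n → ℕ} → (∀ g → f g ≤ h g) → ∑ʷ n f ≤ ∑ʷ n h
∑ʷ-mono-≤ zero f≤h = f≤h []
∑ʷ-mono-≤ (suc n) {f} {h} f≤h =
  ∑-mono-≤ {f = λ v → ∑ʷ n (f ∘ (v ∷_))} {λ v → ∑ʷ n (h ∘ (v ∷_))} λ v → ∑ʷ-mono-≤ n (f≤h ∘ (v ∷_))

∑ʷ-comm-∑ : ∀ n {m} (f : Vec (Fin c) n → Fin m → ℕ) →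
  ∑ʷ n (λ g → ∑[ j < m ] f g j) ≡ ∑[ j < m ] ∑ʷ n (λ g → f g j)
∑ʷ-comm-∑ zero f = refl
∑ʷ-comm-∑ (suc n) f =
  trans (sum-cong-≗ λ v → ∑ʷ-comm-∑ n (f ∘ (v ∷_))) (∑-comm λ v j → ∑ʷ n (λ g → f (v ∷ g) j))

∑ʷ-zero : ∀ n → ∑ʷ {c} n (λ _ → 0) ≡ 0
∑ʷ-zero {c} zero = refl
∑ʷ-zero {c} (suc n) = trans (sum-cong-≗ {c} λ _ → ∑ʷ-zero n) (trans (∑-const c 0) (*-zeroʳ c))

_≟ᶜ_ : (p q : Vec ℕ c) → Dec (p ≡ q)
_≟ᶜ_ = ≡-dec ℕ._≟_

zeros : Vec ℕ c
zeros = replicate _ 0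

incAt decAt : Fin c → Vec ℕ c → Vec ℕ c
incAt v q = updateAt q v suc
decAt v q = updateAt q v ℕ.pred

content : Vec (Fin c) n → Vec ℕ c
content [] = zeros
content (v ∷ g) = incAt v (content g)

multinomial : ℕ → Vec ℕ c → ℕ
multinomial zero q = 𝟙 (q ≟ᶜ zeros)
multinomial {c} (suc m) q = ∑[ v < c ] (𝟙 (1 ≤? lookup q v) * multinomial m (decAt v q))

incAt≡⇔ : ∀ (v : Fin c) q p → (incAt v q ≡ p) ⇔ (1 ≤ lookup p v × q ≡ decAt v p)
incAt≡⇔ zero (x ∷ q) (y ∷ p) = mk⇔ to from
  where
    to : suc x ∷ q ≡ y ∷ p → 1 ≤ y × x ∷ q ≡ ℕ.pred y ∷ p
    to refl = s≤s z≤n , refl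
    from : 1 ≤ y × x ∷ q ≡ ℕ.pred y ∷ p → suc x ∷ q ≡ y ∷ p
    from (s≤s z≤n , refl) = refl
incAt≡⇔ (suc v) (x ∷ q) (y ∷ p) = mk⇔ to from
  where
    to : x ∷ incAt v q ≡ y ∷ p → 1 ≤ lookup p v × x ∷ q ≡ y ∷ decAt v p
    to refl with Equivalence.to (incAt≡⇔ v q p) refl
    ... | 1≤ , q≡ = 1≤ , cong (x ∷_) q≡
    from : 1 ≤ lookup p v × x ∷ q ≡ y ∷ decAt v p → x ∷ incAt v q ≡ y ∷ p
    from (1≤ , refl) = cong (y ∷_) (Equivalence.from (incAt≡⇔ v q p) (1≤ , refl))

𝟙-incAt : ∀ (v : Fin c) q p → 𝟙 (incAt v q ≟ᶜ p) ≡ 𝟙 (1 ≤? lookup p v) * 𝟙 (q ≟ᶜ decAt v p)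
𝟙-incAt v q p = trans (𝟙-cong (incAt≡⇔ v q p) (incAt v q ≟ᶜ p) (1≤? ×-dec q≟)) (𝟙-× 1≤? q≟)
  where
    1≤? : Dec (1 ≤ lookup p v)
    1≤? = 1 ≤? lookup p v
    q≟ : Dec (q ≡ decAt v p)
    q≟ = q ≟ᶜ decAt v p

∑ʷ-content≡multinomial : ∀ n (p : Vec ℕ c) → ∑ʷ n (λ g → 𝟙 (content g ≟ᶜ p)) ≡ multinomial n p
∑ʷ-content≡multinomial zero p = 𝟙-cong (mk⇔ sym sym) (zeros ≟ᶜ p) (p ≟ᶜ zeros)
∑ʷ-content≡multinomial (suc n) p = sum-cong-≗ λ v → begin
    ∑ʷ n (λ g → 𝟙 (incAt v (content g) ≟ᶜ p))
  ≡⟨ ∑ʷ-cong n (λ g → 𝟙-incAt v (content g) p) ⟩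
    ∑ʷ n (λ g → 𝟙 (1 ≤? lookup p v) * 𝟙 (content g ≟ᶜ decAt v p))
  ≡⟨ sym (*-distribˡ-∑ʷ n (𝟙 (1 ≤? lookup p v)) (λ g → 𝟙 (content g ≟ᶜ decAt v p))) ⟩
    𝟙 (1 ≤? lookup p v) * ∑ʷ n (λ g → 𝟙 (content g ≟ᶜ decAt v p))
  ≡⟨ cong (𝟙 (1 ≤? lookup p v) *_) (∑ʷ-content≡multinomial n (decAt v p)) ⟩
    𝟙 (1 ≤? lookup p v) * multinomial n (decAt v p)
  ∎
  where open ≡-Reasoning

sum-replicate : ∀ c d → Vec.sum (replicate c d) ≡ c * d
sum-replicate zero d = refl
sum-replicate (suc c) d = cong (d +_) (sum-replicate c d)

sum≡0⇒≡zeros : ∀ (q : Vec ℕ c) → Vec.sum q ≡ 0 → q ≡ zeros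
sum≡0⇒≡zeros [] _ = refl
sum≡0⇒≡zeros (zero ∷ q) e = cong (0 ∷_) (sum≡0⇒≡zeros q e)

sum≡suc⇒positive : ∀ (q : Vec ℕ c) m → Vec.sum q ≡ suc m →
  ∃ λ v → 1 ≤ lookup q v × Vec.sum (decAt v q) ≡ m
sum≡suc⇒positive (zero ∷ q) m e with sum≡suc⇒positive q m e
... | v , 1≤ , e′ = suc v , 1≤ , e′
sum≡suc⇒positive (suc x ∷ q) m e = zero , s≤s z≤n , suc-injective e

multinomial-pos : ∀ m (q : Vec ℕ c) → Vec.sum q ≡ m → 1 ≤ multinomial m q
multinomial-pos zero q e = ≤-reflexive (sym (𝟙-yes (sum≡0⇒≡zeros q e) (q ≟ᶜ zeros)))
multinomial-pos {c} (suc m) q e with sum≡suc⇒positive q m e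
... | v , 1≤ , e′ = begin
    1
  ≤⟨ multinomial-pos m (decAt v q) e′ ⟩
    multinomial m (decAt v q)
  ≡⟨ sym (*-identityˡ _) ⟩
    1 * multinomial m (decAt v q)
  ≡⟨ cong (_* multinomial m (decAt v q)) (sym (𝟙-yes 1≤ (1 ≤? lookup q v))) ⟩
    𝟙 (1 ≤? lookup q v) * multinomial m (decAt v q)
  ≤⟨ ∑-term-≤ (λ u → 𝟙 (1 ≤? lookup q u) * multinomial m (decAt u q)) v ⟩
    multinomial (suc m) q
  ∎
  where open ≤-Reasoning

mask : (Fin c → Bool) → Vec ℕ c → Vec ℕ c
mask w [] = []
mask w (x ∷ p) = (if w zero then x else 0) ∷ mask (w ∘ suc) p

lookup-mask-true : ∀ (w : Fin c → Bool) v p → w v ≡ true → lookup (mask w p) v ≡ lookup p v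
lookup-mask-true w zero (x ∷ p) wv rewrite wv = refl
lookup-mask-true w (suc v) (x ∷ p) wv = lookup-mask-true (w ∘ suc) v p wv

lookup-mask-false : ∀ (w : Fin c → Bool) v p → w v ≡ false → lookup (mask w p) v ≡ 0
lookup-mask-false w zero (x ∷ p) wv rewrite wv = refl
lookup-mask-false w (suc v) (x ∷ p) wv = lookup-mask-false (w ∘ suc) v p wv

decAt-mask-true : ∀ (w : Fin c → Bool) v p → w v ≡ true → decAt v (mask w p) ≡ mask w (decAt v p)
decAt-mask-true w zero (x ∷ p) wv rewrite wv = refl
decAt-mask-true w (suc v) (x ∷ p) wv = cong (_ ∷_) (decAt-mask-true (w ∘ suc) v p wv)

mask-decAt-false : ∀ (w : Fin c → Bool) v p → w v ≡ false → mask w (decAt v p) ≡ mask w p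
mask-decAt-false w zero (x ∷ p) wv rewrite wv = refl
mask-decAt-false w (suc v) (x ∷ p) wv = cong (_ ∷_) (mask-decAt-false (w ∘ suc) v p wv)

≡zeros⇔masks≡zeros : ∀ (w : Fin c → Bool) p →
  (p ≡ zeros) ⇔ (mask w p ≡ zeros × mask (not ∘ w) p ≡ zeros)
≡zeros⇔masks≡zeros w [] = mk⇔ (λ _ → refl , refl) (λ _ → refl)
≡zeros⇔masks≡zeros w (x ∷ p) with w zero | ≡zeros⇔masks≡zeros (w ∘ suc) p
... | true | IH = mk⇔ to from
  where
    to : x ∷ p ≡ zeros → x ∷ mask (w ∘ suc) p ≡ zeros × 0 ∷ mask (not ∘ w ∘ suc) p ≡ zeros
    to refl = let (m , m′) = Equivalence.to IH refl in cong (0 ∷_) m , cong (0 ∷_) m′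
    from : x ∷ mask (w ∘ suc) p ≡ zeros × 0 ∷ mask (not ∘ w ∘ suc) p ≡ zeros → x ∷ p ≡ zeros
    from (e , e′) with ∷-injective e
    ... | refl , m = cong (0 ∷_) (Equivalence.from IH (m , ∷-injectiveʳ e′))
... | false | IH = mk⇔ to from
  where
    to : x ∷ p ≡ zeros → 0 ∷ mask (w ∘ suc) p ≡ zeros × x ∷ mask (not ∘ w ∘ suc) p ≡ zeros
    to refl = let (m , m′) = Equivalence.to IH refl in cong (0 ∷_) m , cong (0 ∷_) m′
    from : 0 ∷ mask (w ∘ suc) p ≡ zeros × x ∷ mask (not ∘ w ∘ suc) p ≡ zeros → x ∷ p ≡ zeros
    from (e , e′) with ∷-injective e′
    ... | refl , m′ = cong (0 ∷_) (Equivalence.from IH (∷-injectiveʳ e , m′))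

if-then-0≡*𝕀 : ∀ b d → (if b then d else 0) ≡ d * 𝕀 b
if-then-0≡*𝕀 true d = sym (*-identityʳ d)
if-then-0≡*𝕀 false d = sym (*-zeroʳ d)

sum-mask-replicate : ∀ (w : Fin c → Bool) d → Vec.sum (mask w (replicate c d)) ≡ d * ∑[ v < c ] 𝕀 (w v)
sum-mask-replicate {zero} w d = sym (*-zeroʳ d)
sum-mask-replicate {suc c} w d = begin
    (if w zero then d else 0) + Vec.sum (mask (w ∘ suc) (replicate c d))
  ≡⟨ cong₂ _+_ (if-then-0≡*𝕀 (w zero) d) (sum-mask-replicate (w ∘ suc) d) ⟩
    d * 𝕀 (w zero) + d * ∑[ v < c ] 𝕀 (w (suc v))
  ≡⟨ sym (*-distribˡ-+ d (𝕀 (w zero)) _) ⟩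
    d * ∑[ v < suc c ] 𝕀 (w v)
  ∎
  where open ≡-Reasoning

sum-mask-incAt : ∀ (w : Fin c → Bool) v q → Vec.sum (mask w (incAt v q)) ≡ 𝕀 (w v) + Vec.sum (mask w q)
sum-mask-incAt w zero (x ∷ q) with w zero
... | true = refl
... | false = refl
sum-mask-incAt w (suc v) (x ∷ q) = trans (cong ((if w zero then x else 0) +_) (sum-mask-incAt (w ∘ suc) v q))
                                        (+-x∙yz≈y∙xz (if w zero then x else 0) (𝕀 (w (suc v))) _)

∣∷∣ : ∀ b (A : Subset n) → ∣ b ∷ A ∣ ≡ 𝕀 b + ∣ A ∣
∣∷∣ true A = refl
∣∷∣ false A = refl

∣map∣≡sum-mask-content : ∀ (w : Fin c → Bool) (g : Vec (Fin c) n) → ∣ map w g ∣ ≡ Vec.sum (mask w (content g))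
∣map∣≡sum-mask-content {c} w [] = sym (trans (sum-mask-replicate w 0) (*-zeroˡ (∑[ v < c ] 𝕀 (w v))))
∣map∣≡sum-mask-content w (v ∷ g) = begin
    ∣ w v ∷ map w g ∣                             ≡⟨ ∣∷∣ (w v) (map w g) ⟩
    𝕀 (w v) + ∣ map w g ∣                         ≡⟨ cong (𝕀 (w v) +_) (∣map∣≡sum-mask-content w g) ⟩
    𝕀 (w v) + Vec.sum (mask w (content g))        ≡⟨ sym (sum-mask-incAt w v (content g)) ⟩
    Vec.sum (mask w (incAt v (content g)))        ∎
  where open ≡-Reasoning

multinomial-peel : ∀ (w w′ : Fin c → Bool) → (∀ v → w v ≡ true → w′ v ≡ false) → ∀ k k′ p →
  ∑[ v < c ] ((𝟙 (1 ≤? lookup p v) * 𝕀 (w v)) *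
              (multinomial k (mask w (decAt v p)) * multinomial k′ (mask w′ (decAt v p))))
  ≡ multinomial (suc k) (mask w p) * multinomial k′ (mask w′ p)
multinomial-peel {c} w w′ disjoint k k′ p =
  trans (sum-cong-≗ term)
        (sym (*-distribʳ-sum (multinomial k′ (mask w′ p))
                             (λ v → 𝟙 (1 ≤? lookup (mask w p) v) * multinomial k (decAt v (mask w p)))))
  where
    term : ∀ v → (𝟙 (1 ≤? lookup p v) * 𝕀 (w v)) *
                 (multinomial k (mask w (decAt v p)) * multinomial k′ (mask w′ (decAt v p)))
               ≡ 𝟙 (1 ≤? lookup (mask w p) v) * multinomial k (decAt v (mask w p)) * multinomial k′ (mask w′ p)
    term v with w v in wv
    ... | false rewrite lookup-mask-false w v p wv | *-zeroʳ (𝟙 (1 ≤? lookup p v)) = refl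
    ... | true = begin
        (a * 1) * (M * M′)                                   ≡⟨ cong (_* (M * M′)) (*-identityʳ a) ⟩
        a * (M * M′)                                         ≡⟨ sym (*-assoc a M M′) ⟩
        a * M * M′
          ≡⟨ cong₂ (λ x X → 𝟙 (1 ≤? x) * multinomial k X * M′)
                   (sym (lookup-mask-true w v p wv)) (sym (decAt-mask-true w v p wv)) ⟩
        𝟙 (1 ≤? lookup (mask w p) v) * multinomial k (decAt v (mask w p)) * M′
          ≡⟨ cong (λ Y → 𝟙 (1 ≤? lookup (mask w p) v) * multinomial k (decAt v (mask w p)) * multinomial k′ Y)
                  (mask-decAt-false w′ v p (disjoint v wv)) ⟩
        𝟙 (1 ≤? lookup (mask w p) v) * multinomial k (decAt v (mask w p)) * multinomial k′ (mask w′ p)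
      ∎
      where
        open ≡-Reasoning
        a M M′ : ℕ
        a = 𝟙 (1 ≤? lookup p v)
        M = multinomial k (mask w (decAt v p))
        M′ = multinomial k′ (mask w′ (decAt v p))

_≟ˢ_ : (A B : Subset n) → Dec (A ≡ B)
_≟ˢ_ = ≡-dec Bool._≟_

∑ʷ-content-pattern : ∀ (w : Fin c → Bool) n (A : Subset n) p →
  ∑ʷ n (λ g → 𝟙 (content g ≟ᶜ p) * 𝟙 (map w g ≟ˢ A))
  ≡ multinomial (∣ A ∣) (mask w p) * multinomial (∣ ∁ A ∣) (mask (not ∘ w) p)
∑ʷ-content-pattern w zero [] p = begin
    𝟙 (zeros ≟ᶜ p) * 1
  ≡⟨ *-identityʳ _ ⟩
    𝟙 (zeros ≟ᶜ p)
  ≡⟨ 𝟙-cong (mk⇔ (to ∘ sym) (sym ∘ from)) (zeros ≟ᶜ p)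
            ((mask w p ≟ᶜ zeros) ×-dec (mask (not ∘ w) p ≟ᶜ zeros)) ⟩
    𝟙 ((mask w p ≟ᶜ zeros) ×-dec (mask (not ∘ w) p ≟ᶜ zeros))
  ≡⟨ 𝟙-× (mask w p ≟ᶜ zeros) (mask (not ∘ w) p ≟ᶜ zeros) ⟩
    𝟙 (mask w p ≟ᶜ zeros) * 𝟙 (mask (not ∘ w) p ≟ᶜ zeros)
  ∎
  where
    open ≡-Reasoning
    open Equivalence (≡zeros⇔masks≡zeros w p)
∑ʷ-content-pattern {c} w (suc n) (a ∷ A) p = trans (sum-cong-≗ peel) (by-first-letter a)
  where
    pos : Fin c → ℕ
    pos v = 𝟙 (1 ≤? lookup p v)
    matches : Vec ℕ c → Vec (Fin c) n → ℕ
    matches q g = 𝟙 (content g ≟ᶜ q) * 𝟙 (map w g ≟ˢ A)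
    rest : Fin c → ℕ
    rest v = multinomial (∣ A ∣) (mask w (decAt v p)) * multinomial (∣ ∁ A ∣) (mask (not ∘ w) (decAt v p))
    peel : ∀ v → ∑ʷ n (λ g → 𝟙 (incAt v (content g) ≟ᶜ p) * 𝟙 ((w v ∷ map w g) ≟ˢ (a ∷ A)))
               ≡ (pos v * 𝟙 (w v Bool.≟ a)) * rest v
    peel v = begin
        ∑ʷ n (λ g → 𝟙 (incAt v (content g) ≟ᶜ p) * 𝟙 ((w v ∷ map w g) ≟ˢ (a ∷ A)))
      ≡⟨ ∑ʷ-cong n (λ g → trans (cong₂ _*_ (𝟙-incAt v (content g) p) (𝟙-× (w v Bool.≟ a) (map w g ≟ˢ A)))
                                ([m*n]*[o*p]≡[m*o]*[n*p] (pos v) (𝟙 (content g ≟ᶜ decAt v p))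
                                                          (𝟙 (w v Bool.≟ a)) (𝟙 (map w g ≟ˢ A)))) ⟩
        ∑ʷ n (λ g → (pos v * 𝟙 (w v Bool.≟ a)) * matches (decAt v p) g)
      ≡⟨ sym (*-distribˡ-∑ʷ n (pos v * 𝟙 (w v Bool.≟ a)) (matches (decAt v p))) ⟩
        (pos v * 𝟙 (w v Bool.≟ a)) * ∑ʷ n (matches (decAt v p))
      ≡⟨ cong (pos v * 𝟙 (w v Bool.≟ a) *_) (∑ʷ-content-pattern w n A (decAt v p)) ⟩
        (pos v * 𝟙 (w v Bool.≟ a)) * rest v
      ∎
      where open ≡-Reasoning
    by-first-letter : ∀ a → ∑[ v < c ] ((pos v * 𝟙 (w v Bool.≟ a)) * rest v)
      ≡ multinomial (∣ a ∷ A ∣) (mask w p) * multinomial (∣ ∁ (a ∷ A) ∣) (mask (not ∘ w) p)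
    by-first-letter true =
      trans (sum-cong-≗ λ v → cong (λ i → (pos v * i) * rest v) (𝟙-≟true (w v)))
            (multinomial-peel w (not ∘ w) (λ v → cong not) (∣ A ∣) (∣ ∁ A ∣) p)
    by-first-letter false =
      trans (sum-cong-≗ λ v → cong₂ (λ i r → (pos v * i) * r) (𝟙-≟false (w v))
                                     (*-comm (multinomial (∣ A ∣) (mask w (decAt v p))) _))
            (trans (multinomial-peel (not ∘ w) w (λ v e → trans (sym (not-involutive (w v))) (cong not e))
                                     (∣ ∁ A ∣) (∣ A ∣) p)
                   (*-comm _ (multinomial (∣ A ∣) (mask w p))))

-- Intersections and unions of sparse families

degree : (Fin l → Subset n) → Fin n → ℕ
degree {l} A x = ∑[ i < l ] 𝕀 (lookup (A i) x)

∣p∣≤∑ : ∀ (B : Subset l) (f : Fin l → ℕ) → (∀ i → i ∈ B → 1 ≤ f i) → ∣ B ∣ ≤ sum f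
∣p∣≤∑ [] f _ = z≤n
∣p∣≤∑ (true ∷ B) f B⊆f = +-mono-≤ (B⊆f zero here) (∣p∣≤∑ B (f ∘ suc) (λ i → B⊆f (suc i) ∘ there))
∣p∣≤∑ (false ∷ B) f B⊆f = ≤-trans (∣p∣≤∑ B (f ∘ suc) (λ i → B⊆f (suc i) ∘ there)) (m≤n+m _ (f zero))

intersectionEmpty-if-degree< : ∀ (A : Fin l → Subset n) B → (∀ x → degree A x < ∣ B ∣) →
  IntersectionEmpty A B
intersectionEmpty-if-degree< {l} A B sparse x
  with ¬∀⟶∃¬ l (λ i → i ∈ B → x ∈ A i) (λ i → (i ∈? B) →-dec (x ∈? A i)) all-contain
  where
    all-contain : ¬ (∀ i → i ∈ B → x ∈ A i)
    all-contain B⊆ =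
      <⇒≱ (sparse x) (∣p∣≤∑ B _ λ i i∈B → ≤-reflexive (cong 𝕀 (sym ([]=⇒lookup (B⊆ i i∈B)))))
... | i , ¬[i∈B→x∈Ai] with i ∈? B | x ∈? A i
...   | yes i∈B | no x∉Ai = i , i∈B , x∉Ai
...   | yes _   | yes x∈Ai = ⊥-elim (¬[i∈B→x∈Ai] λ _ → x∈Ai)
...   | no i∉B  | _ = ⊥-elim (¬[i∈B→x∈Ai] (⊥-elim ∘ i∉B))

unionFull-if-codegree< : ∀ (A : Fin l → Subset n) B → (∀ x → degree (∁ ∘ A) x < ∣ B ∣) →
  UnionFull A B
unionFull-if-codegree< A B sparse x with intersectionEmpty-if-degree< (∁ ∘ A) B sparse x
... | i , i∈B , x∉∁Ai = i , i∈B , x∉∁p⇒x∈p x∉∁Ai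

degree-family≤ : ∀ (f : Fin c → Fin c → Bool) (g : Vec (Fin c) n) (ι : Fin l → Fin c) →
  Injective _≡_ _≡_ ι → ∀ x → degree (λ i → map (f (ι i)) g) x ≤ ∑[ j < c ] 𝕀 (f j (lookup g x))
degree-family≤ {l = l} f g ι ι-inj x = begin
    ∑[ i < l ] 𝕀 (lookup (map (f (ι i)) g) x)  ≡⟨ sum-cong-≗ {l} (λ i → cong 𝕀 (lookup-map x (f (ι i)) g)) ⟩
    ∑[ i < l ] 𝕀 (f (ι i) (lookup g x))        ≤⟨ ∑-injective-≤ ι ι-inj (λ j → 𝕀 (f j (lookup g x))) ⟩
    ∑[ j < _ ] 𝕀 (f j (lookup g x))            ∎
  where open ≤-Reasoning

_∈ᶠ?_ : ∀ (A : Subset n) F → Dec (A ∈ᴸ F)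
_∈ᶠ?_ = Membershipᴰ._∈?_ _≟ˢ_

𝟙-∈-∷ : ∀ {A B : Subset n} {F} → B ∉ᴸ F → 𝟙 (A ∈ᶠ? (B ∷ F)) ≡ 𝟙 (A ≟ˢ B) + 𝟙 (A ∈ᶠ? F)
𝟙-∈-∷ {A = A} {B} {F} B∉F with A ≟ˢ B
... | yes refl = cong suc (sym (𝟙-no B∉F (A ∈ᶠ? F)))
... | no _ = refl

combinations : ∀ n → ℕ → List (Subset n)
combinations zero zero = (Vec.[]) ∷ []
combinations zero (suc k) = []
combinations (suc n) zero = List.map (false ∷_) (combinations n zero)
combinations (suc n) (suc k) =
  List.map (true ∷_) (combinations n k) List.++ List.map (false ∷_) (combinations n (suc k))

length-combinations : ∀ n k → length (combinations n k) ≡ n C k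
length-combinations zero zero = refl
length-combinations zero (suc k) = sym (k>n⇒nCk≡0 {k = suc k} (s≤s z≤n))
length-combinations (suc n) zero =
  trans (length-map (false ∷_) (combinations n zero)) (length-combinations n zero)
length-combinations (suc n) (suc k) = begin
    length (List.map (true ∷_) (combinations n k) List.++ List.map (false ∷_) (combinations n (suc k)))
  ≡⟨ length-++ (List.map (true ∷_) (combinations n k)) ⟩
    length (List.map (true ∷_) (combinations n k)) + length (List.map (false ∷_) (combinations n (suc k)))
  ≡⟨ cong₂ _+_ (trans (length-map _ (combinations n k)) (length-combinations n k))
               (trans (length-map _ (combinations n (suc k))) (length-combinations n (suc k))) ⟩
    n C k + n C suc k
  ≡⟨ nCk+nC[k+1]≡[n+1]C[k+1] n k ⟩
    suc n C suc k
  ∎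
  where open ≡-Reasoning

combinations-unique : ∀ n k → Unique (combinations n k)
combinations-unique zero zero = All.[] AllPairs.∷ AllPairs.[]
combinations-unique zero (suc k) = AllPairs.[]
combinations-unique (suc n) zero = Uniqueₚ.map⁺ ∷-injectiveʳ (combinations-unique n zero)
combinations-unique (suc n) (suc k) =
  Uniqueₚ.++⁺ (Uniqueₚ.map⁺ ∷-injectiveʳ (combinations-unique n k))
              (Uniqueₚ.map⁺ ∷-injectiveʳ (combinations-unique n (suc k)))
              heads-differ
  where
    heads-differ : ∀ {A} → A ∈ᴸ List.map (true ∷_) (combinations n k) ×
                           A ∈ᴸ List.map (false ∷_) (combinations n (suc k)) → ⊥
    heads-differ (A∈ , A∈′) with ∈-map⁻ (true ∷_) A∈ | ∈-map⁻ (false ∷_) A∈′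
    ... | _ , _ , refl | _ , _ , ()

combinations-size : ∀ n k → All (λ A → ∣ A ∣ ≡ k) (combinations n k)
combinations-size zero zero = refl All.∷ All.[]
combinations-size zero (suc k) = All.[]
combinations-size (suc n) zero = Allₚ.map⁺ (combinations-size n zero)
combinations-size (suc n) (suc k) =
  Allₚ.++⁺ (Allₚ.map⁺ (All.map (cong suc) (combinations-size n k))) (Allₚ.map⁺ (combinations-size n (suc k)))

∈-combinations : ∀ n k (A : Subset n) → ∣ A ∣ ≡ k → A ∈ᴸ combinations n k
∈-combinations zero zero [] _ = here refl
∈-combinations (suc n) zero (false ∷ A) ∣A∣ = ∈-map⁺ (false ∷_) (∈-combinations n zero A ∣A∣)
∈-combinations (suc n) (suc k) (true ∷ A) ∣A∣ =
  ∈-++⁺ˡ (∈-map⁺ (true ∷_) (∈-combinations n k A (suc-injective ∣A∣)))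
∈-combinations (suc n) (suc k) (false ∷ A) ∣A∣ =
  ∈-++⁺ʳ (List.map (true ∷_) (combinations n k)) (∈-map⁺ (false ∷_) (∈-combinations n (suc k) A ∣A∣))

[1+k]*[1+n]C[1+k]≡[1+n]*nCk : ∀ n k → suc k * (suc n C suc k) ≡ suc n * (n C k)
[1+k]*[1+n]C[1+k]≡[1+n]*nCk zero zero = refl
[1+k]*[1+n]C[1+k]≡[1+n]*nCk zero (suc k) = *-zeroʳ (2 + k)
[1+k]*[1+n]C[1+k]≡[1+n]*nCk (suc n) zero =
  trans (+-identityʳ _) (trans (nC1≡n (2 + n)) (sym (*-identityʳ (2 + n))))
[1+k]*[1+n]C[1+k]≡[1+n]*nCk (suc n) (suc k) = begin
    (2 + k) * ((2 + n) C (2 + k))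
  ≡⟨ cong ((2 + k) *_) (sym (nCk+nC[k+1]≡[n+1]C[k+1] (suc n) (suc k))) ⟩
    (2 + k) * (X + Y)
  ≡⟨ *-distribˡ-+ (2 + k) X Y ⟩
    (X + (1 + k) * X) + (2 + k) * Y
  ≡⟨ cong₂ (λ u v → (X + u) + v)
           ([1+k]*[1+n]C[1+k]≡[1+n]*nCk n k) ([1+k]*[1+n]C[1+k]≡[1+n]*nCk n (suc k)) ⟩
    (X + (1 + n) * (n C k)) + (1 + n) * (n C suc k)
  ≡⟨ +-assoc X _ _ ⟩
    X + ((1 + n) * (n C k) + (1 + n) * (n C suc k))
  ≡⟨ cong (X +_) (sym (*-distribˡ-+ (1 + n) (n C k) (n C suc k))) ⟩
    X + (1 + n) * (n C k + n C suc k)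
  ≡⟨ cong (λ u → X + (1 + n) * u) (nCk+nC[k+1]≡[n+1]C[k+1] n k) ⟩
    (2 + n) * X
  ∎
  where
    open ≡-Reasoning
    X Y : ℕ
    X = suc n C suc k
    Y = suc n C (2 + k)

c*nCk≡s*[1+n]C[1+k] : ∀ n k c s → c * suc k ≡ s * suc n → c * (n C k) ≡ s * (suc n C suc k)
c*nCk≡s*[1+n]C[1+k] n k c s c[1+k]≡s[1+n] = *-cancelʳ-≡ (c * (n C k)) (s * N) (suc n) (begin
    c * (n C k) * suc n    ≡⟨ *-assoc c (n C k) (suc n) ⟩
    c * ((n C k) * suc n)  ≡⟨ cong (c *_) (*-comm (n C k) (suc n)) ⟩
    c * (suc n * (n C k))  ≡⟨ cong (c *_) (sym ([1+k]*[1+n]C[1+k]≡[1+n]*nCk n k)) ⟩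
    c * (suc k * N)        ≡⟨ sym (*-assoc c (suc k) N) ⟩
    c * suc k * N          ≡⟨ cong (_* N) c[1+k]≡s[1+n] ⟩
    s * suc n * N          ≡⟨ *-xy∙z≈xz∙y s (suc n) N ⟩
    s * N * suc n          ∎)
  where
    open ≡-Reasoning
    N : ℕ
    N = suc n C suc k

c*nC[1+k]≡[c∸s]*[1+n]C[1+k] : ∀ n k c s → c * (n C k) ≡ s * (suc n C suc k) →
  c * (n C suc k) ≡ (c ∸ s) * (suc n C suc k)
c*nC[1+k]≡[c∸s]*[1+n]C[1+k] n k c s c*nCk≡s*N = sym (begin
    (c ∸ s) * N                                  ≡⟨ *-distribʳ-∸ N c s ⟩
    c * N ∸ s * N
      ≡⟨ cong₂ _∸_ (cong (c *_) (sym (nCk+nC[k+1]≡[n+1]C[k+1] n k))) (sym c*nCk≡s*N) ⟩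
    c * (n C k + n C suc k) ∸ c * (n C k)        ≡⟨ cong (_∸ c * (n C k)) (*-distribˡ-+ c (n C k) (n C suc k)) ⟩
    c * (n C k) + c * (n C suc k) ∸ c * (n C k)  ≡⟨ m+n∸m≡n (c * (n C k)) _ ⟩
    c * (n C suc k)                              ∎)
  where
    open ≡-Reasoning
    N : ℕ
    N = suc n C suc k

containing₀ avoiding₀ : ∀ n k → List (Subset (suc n))
containing₀ n k = List.map (true ∷_) (combinations n k)
avoiding₀ n k = List.map (false ∷_) (combinations n k)

∈-containing₀ : ∀ {n k} {A : Subset (suc n)} → A ∈ᴸ containing₀ n k → zero ∈ A
∈-containing₀ A∈ with ∈-map⁻ (true ∷_) A∈
... | _ , _ , refl = here

∈-avoiding₀ : ∀ {n k} {A : Subset (suc n)} → A ∈ᴸ avoiding₀ n k → zero ∉ A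
∈-avoiding₀ A∈ with ∈-map⁻ (false ∷_) A∈
... | _ , _ , refl = λ ()

containing₀-admissible : ∀ n k s k₂ → Admissible (suc n) (suc k) (suc s) (suc s) k₂ (containing₀ n k)
containing₀-admissible n k s k₂ =
  Uniqueₚ.map⁺ ∷-injectiveʳ (combinations-unique n k) ,
  Allₚ.map⁺ (All.map (cong suc) (combinations-size n k)) ,
  λ (A , A∈ , intersections , _) →
    let (i , _ , 0∉Ai) = intersections ⊤ (∣⊤∣≡n (suc s)) zero in 0∉Ai (∈-containing₀ (A∈ i))

avoiding₀-admissible : ∀ n k k₁ r → Admissible (suc n) k (suc r) k₁ (suc r) (avoiding₀ n k)
avoiding₀-admissible n k k₁ r =
  Uniqueₚ.map⁺ ∷-injectiveʳ (combinations-unique n k) ,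
  Allₚ.map⁺ (combinations-size n k) ,
  λ (A , A∈ , _ , unions) →
    let (i , _ , 0∈Ai) = unions ⊤ (∣⊤∣≡n (suc r)) zero in ∈-avoiding₀ (A∈ i) 0∈Ai

-- Cyclic windows

∑-rotate₁ : ∀ c′ (k : ℕ → ℕ) → ∑[ v < suc c′ ] k (suc (toℕ v) % suc c′) ≡ ∑[ v < suc c′ ] k (toℕ v)
∑-rotate₁ c′ k = begin
    ∑[ v < suc c′ ] k (suc (toℕ v) % suc c′)
  ≡⟨ sum-init-last (λ v → k (suc (toℕ v) % suc c′)) ⟩
    ∑[ i < c′ ] k (suc (toℕ (inject₁ i)) % suc c′) + k (suc (toℕ (fromℕ c′)) % suc c′)
  ≡⟨ cong₂ _+_ (sum-cong-≗ {c′} λ i → cong k (trans (cong (λ x → suc x % suc c′) (Finₚ.toℕ-inject₁ i))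
                                                (m<n⇒m%n≡m (s≤s (Finₚ.toℕ<n i)))))
               (cong k (trans (cong (λ x → suc x % suc c′) (Finₚ.toℕ-fromℕ c′)) (n%n≡0 (suc c′)))) ⟩
    ∑[ i < c′ ] k (suc (toℕ i)) + k 0
  ≡⟨ +-comm _ (k 0) ⟩
    ∑[ v < suc c′ ] k (toℕ v)
  ∎
  where open ≡-Reasoning

[m%n+k]%n≡[m+k]%n : ∀ m k n .{{_ : NonZero n}} → (m % n + k) % n ≡ (m + k) % n
[m%n+k]%n≡[m+k]%n m k n = begin
    (m % n + k) % n               ≡⟨ sym ([m+kn]%n≡m%n (m % n + k) (m / n) n) ⟩
    (m % n + k + m / n * n) % n   ≡⟨ cong (_% n) (+-xy∙z≈xz∙y (m % n) k (m / n * n)) ⟩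
    (m % n + m / n * n + k) % n   ≡⟨ cong (λ x → (x + k) % n) (sym (m≡m%n+[m/n]*n m n)) ⟩
    (m + k) % n                   ∎
  where open ≡-Reasoning

∑-rotate : ∀ c .{{_ : NonZero c}} j (h : ℕ → ℕ) →
  ∑[ v < c ] h ((toℕ v + j) % c) ≡ ∑[ v < c ] h (toℕ v)
∑-rotate c@(suc _) zero h =
  sum-cong-≗ {c} λ v → cong h (trans (cong (_% c) (+-identityʳ (toℕ v))) (m<n⇒m%n≡m (Finₚ.toℕ<n v)))
∑-rotate c@(suc c′) (suc j) h = begin
    ∑[ v < c ] h ((toℕ v + suc j) % c)
  ≡⟨ sum-cong-≗ {c} (λ v → cong h (trans (cong (_% c) (+-suc (toℕ v) j))
                                      (sym ([m%n+k]%n≡[m+k]%n (suc (toℕ v)) j c)))) ⟩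
    ∑[ v < c ] h ((suc (toℕ v) % c + j) % c)
  ≡⟨ ∑-rotate₁ c′ (λ u → h ((u + j) % c)) ⟩
    ∑[ v < c ] h ((toℕ v + j) % c)
  ≡⟨ ∑-rotate c j h ⟩
    ∑[ v < c ] h (toℕ v)
  ∎
  where open ≡-Reasoning

∑-below : ∀ c s → s ≤ c → ∑[ v < c ] 𝕀 (toℕ v <ᵇ s) ≡ s
∑-below c zero _ = trans (∑-const c 0) (*-zeroʳ c)
∑-below (suc c) (suc s) s≤c = cong suc (∑-below c s (ℕ.s≤s⁻¹ s≤c))

module Windows (c s : ℕ) .{{_ : NonZero c}} (s≤c : s ≤ c) where

  window : Fin c → Fin c → Bool
  window j v = (toℕ v + toℕ j) % c <ᵇ s

  ∑-window : ∀ j → ∑[ v < c ] 𝕀 (window j v) ≡ s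
  ∑-window j = trans (∑-rotate c (toℕ j) (λ u → 𝕀 (u <ᵇ s))) (∑-below c s s≤c)

  ∑-windows∋ : ∀ v → ∑[ j < c ] 𝕀 (window j v) ≡ s
  ∑-windows∋ v =
    trans (sum-cong-≗ {c} λ j → cong (λ u → 𝕀 (u % c <ᵇ s)) (+-comm (toℕ v) (toℕ j))) (∑-window v)

  ∑-windows∌ : ∀ v → ∑[ j < c ] 𝕀 (not (window j v)) ≡ c ∸ s
  ∑-windows∌ v = begin
    outside                                  ≡⟨ sym (m+n∸m≡n s outside) ⟩
    s + outside ∸ s                          ≡⟨ cong (λ x → x + outside ∸ s) (sym (∑-windows∋ v)) ⟩
    ∑[ j < c ] 𝕀 (window j v) + outside ∸ s  ≡⟨ cong (_∸ s) (∑-𝕀+∑-𝕀-not (λ j → window j v)) ⟩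
    c ∸ s                                    ∎
    where
      open ≡-Reasoning
      outside : ℕ
      outside = ∑[ j < c ] 𝕀 (not (window j v))

  χ : Fin c → Vec (Fin c) n → Subset n
  χ j g = map (window j) g

  χ-disjoint : ∀ (g : Vec (Fin c) n) (ι : Fin l → Fin c) → Injective _≡_ _≡_ ι →
    Disjoint (suc s) (suc (c ∸ s)) (λ i → χ (ι i) g)
  χ-disjoint g ι ι-inj = intersections , unions
    where
      intersections : ∀ B → ∣ B ∣ ≡ suc s → IntersectionEmpty (λ i → χ (ι i) g) B
      intersections B ∣B∣ = intersectionEmpty-if-degree< _ B λ x → begin-strict
        degree (λ i → χ (ι i) g) x             ≤⟨ degree-family≤ window g ι ι-inj x ⟩
        ∑[ j < c ] 𝕀 (window j (lookup g x))  ≡⟨ ∑-windows∋ (lookup g x) ⟩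
        s                                      <⟨ n<1+n s ⟩
        suc s                                  ≡⟨ sym ∣B∣ ⟩
        ∣ B ∣                                  ∎
        where open ≤-Reasoning
      unions : ∀ B → ∣ B ∣ ≡ suc (c ∸ s) → UnionFull (λ i → χ (ι i) g) B
      unions B ∣B∣ = unionFull-if-codegree< _ B λ x → begin-strict
        degree (λ i → ∁ (χ (ι i) g)) x
          ≡⟨ sum-cong-≗ (λ i → cong (λ A → 𝕀 (lookup A x)) (sym (map-∘ not (window (ι i)) g))) ⟩
        degree (λ i → map (not ∘ window (ι i)) g) x  ≤⟨ degree-family≤ (λ j → not ∘ window j) g ι ι-inj x ⟩
        ∑[ j < c ] 𝕀 (not (window j (lookup g x)))  ≡⟨ ∑-windows∌ (lookup g x) ⟩
        c ∸ s                                        <⟨ n<1+n (c ∸ s) ⟩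
        suc (c ∸ s)                                  ≡⟨ sym ∣B∣ ⟩
        ∣ B ∣                                        ∎
        where open ≤-Reasoning

  #χ∈F≤ : ∀ {t} (F : List (Subset n)) → Admissible n t (suc l) (suc s) (suc (c ∸ s)) F →
    ∀ (g : Vec (Fin c) n) → ∑[ j < c ] 𝟙 (χ j g ∈ᶠ? F) ≤ l
  #χ∈F≤ {l = l} F (_ , _ , no-disjoint-sequence) g with ∑[ j < c ] 𝟙 (χ j g ∈ᶠ? F) ≤? l
  ... | yes ≤l = ≤l
  ... | no ≰l with injection-from-∑ (λ j → χ j g ∈ᶠ? F) (≰⇒> ≰l)
  ... | ι , ι-inj , ι∈F = ⊥-elim (no-disjoint-sequence ((λ i → χ (ι i) g) , ι∈F , χ-disjoint g ι ι-inj))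

-- The averaging bound

module Averaging (c s : ℕ) .{{_ : NonZero c}} (s≤c : s ≤ c) (d : ℕ) where

  open Windows c s s≤c

  D : Vec ℕ c
  D = replicate c d

  balanced : Vec (Fin c) (c * d) → ℕ
  balanced g = 𝟙 (content g ≟ᶜ D)

  #balanced : ℕ
  #balanced = ∑ʷ (c * d) balanced

  hits : Subset (c * d) → ℕ
  hits A = ∑ʷ (c * d) λ g → balanced g * ∑[ j < c ] 𝟙 (χ j g ≟ˢ A)

  hitsOfSize : ℕ → ℕ
  hitsOfSize k =
    ∑[ j < c ] (multinomial k (mask (window j) D) * multinomial (c * d ∸ k) (mask (not ∘ window j) D))

  hits≡hitsOfSize : ∀ A → hits A ≡ hitsOfSize ∣ A ∣
  hits≡hitsOfSize A = begin
      ∑ʷ (c * d) (λ g → balanced g * ∑[ j < c ] 𝟙 (χ j g ≟ˢ A))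
    ≡⟨ ∑ʷ-cong (c * d) (λ g → *-distribˡ-sum (balanced g) (λ j → 𝟙 (χ j g ≟ˢ A))) ⟩
      ∑ʷ (c * d) (λ g → ∑[ j < c ] (balanced g * 𝟙 (χ j g ≟ˢ A)))
    ≡⟨ ∑ʷ-comm-∑ (c * d) (λ g j → balanced g * 𝟙 (χ j g ≟ˢ A)) ⟩
      ∑[ j < c ] ∑ʷ (c * d) (λ g → balanced g * 𝟙 (χ j g ≟ˢ A))
    ≡⟨ sum-cong-≗ {c} (λ j → ∑ʷ-content-pattern (window j) (c * d) A D) ⟩
      ∑[ j < c ] (multinomial (∣ A ∣) (mask (window j) D) * multinomial (∣ ∁ A ∣) (mask (not ∘ window j) D))
    ≡⟨ sum-cong-≗ {c} (λ j → cong (λ k → multinomial (∣ A ∣) (mask (window j) D) *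
                                          multinomial k (mask (not ∘ window j) D))
                                        (∣∁p∣≡n∸∣p∣ A)) ⟩
      hitsOfSize ∣ A ∣
    ∎
    where open ≡-Reasoning

  hitsIn : List (Subset (c * d)) → ℕ
  hitsIn F = ∑ʷ (c * d) λ g → balanced g * ∑[ j < c ] 𝟙 (χ j g ∈ᶠ? F)

  hitsIn-∷ : ∀ {A F} → A ∉ᴸ F → hitsIn (A ∷ F) ≡ hits A + hitsIn F
  hitsIn-∷ {A} {F} A∉F = trans (∑ʷ-cong (c * d) split) (∑ʷ-distrib-+ (c * d) _ _)
    where
      split : ∀ g → balanced g * ∑[ j < c ] 𝟙 (χ j g ∈ᶠ? (A ∷ F))
                  ≡ balanced g * ∑[ j < c ] 𝟙 (χ j g ≟ˢ A) + balanced g * ∑[ j < c ] 𝟙 (χ j g ∈ᶠ? F)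
      split g = trans (cong (balanced g *_) (trans (sum-cong-≗ {c} λ j → 𝟙-∈-∷ A∉F)
                                                   (∑-distrib-+ (λ j → 𝟙 (χ j g ≟ˢ A)) (λ j → 𝟙 (χ j g ∈ᶠ? F)))))
                      (*-distribˡ-+ (balanced g) _ _)

  hitsIn-length : ∀ {k} F → Unique F → All (λ A → ∣ A ∣ ≡ k) F → hitsIn F ≡ length F * hitsOfSize k
  hitsIn-length [] _ _ =
    trans (∑ʷ-cong (c * d) λ g → trans (cong (balanced g *_) (trans (∑-const c 0) (*-zeroʳ c))) (*-zeroʳ (balanced g)))
          (∑ʷ-zero (c * d))
  hitsIn-length {k} (A ∷ F) A∷F-unique@(_ AllPairs.∷ F-unique) (∣A∣ All.∷ sizes) = begin
      hitsIn (A ∷ F)                   ≡⟨ hitsIn-∷ (Uniqueₚ.Unique[x∷xs]⇒x∉xs A∷F-unique) ⟩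
      hits A + hitsIn F                ≡⟨ cong₂ _+_ (trans (hits≡hitsOfSize A) (cong hitsOfSize ∣A∣))
                                                    (hitsIn-length F F-unique sizes) ⟩
      hitsOfSize k + length F * hitsOfSize k  ∎
    where open ≡-Reasoning

  hitsIn-admissible≤ : ∀ {t l} F → Admissible (c * d) t (suc l) (suc s) (suc (c ∸ s)) F →
    hitsIn F ≤ l * #balanced
  hitsIn-admissible≤ {l = l} F adm = begin
      hitsIn F                              ≤⟨ ∑ʷ-mono-≤ (c * d) (λ g → *-monoʳ-≤ (balanced g) (#χ∈F≤ F adm g)) ⟩
      ∑ʷ (c * d) (λ g → balanced g * l)     ≡⟨ ∑ʷ-cong (c * d) (λ g → *-comm (balanced g) l) ⟩
      ∑ʷ (c * d) (λ g → l * balanced g)     ≡⟨ sym (*-distribˡ-∑ʷ (c * d) l balanced) ⟩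
      l * #balanced                         ∎
    where open ≤-Reasoning

  ∣χ∣ : ∀ j (g : Vec (Fin c) (c * d)) → content g ≡ D → ∣ χ j g ∣ ≡ s * d
  ∣χ∣ j g g-balanced = begin
      ∣ map (window j) g ∣                        ≡⟨ ∣map∣≡sum-mask-content (window j) g ⟩
      Vec.sum (mask (window j) (content g))       ≡⟨ cong (Vec.sum ∘ mask (window j)) g-balanced ⟩
      Vec.sum (mask (window j) D)                 ≡⟨ sum-mask-replicate (window j) d ⟩
      d * ∑[ v < c ] 𝕀 (window j v)               ≡⟨ cong (d *_) (∑-window j) ⟩
      d * s                                       ≡⟨ *-comm d s ⟩
      s * d                                       ∎
    where open ≡-Reasoning

  hitsIn-combinations : hitsIn (combinations (c * d) (s * d)) ≡ c * #balanced
  hitsIn-combinations = trans (∑ʷ-cong (c * d) all-windows) (sym (*-distribˡ-∑ʷ (c * d) c balanced))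
    where
      all-windows : ∀ g → balanced g * ∑[ j < c ] 𝟙 (χ j g ∈ᶠ? combinations (c * d) (s * d)) ≡ c * balanced g
      all-windows g with content g ≟ᶜ D
      ... | no _ = sym (*-zeroʳ c)
      ... | yes g-balanced = begin
          1 * ∑[ j < c ] 𝟙 (χ j g ∈ᶠ? combinations (c * d) (s * d))
        ≡⟨ *-identityˡ _ ⟩
          ∑[ j < c ] 𝟙 (χ j g ∈ᶠ? combinations (c * d) (s * d))
        ≡⟨ sum-cong-≗ {c} (λ j → 𝟙-yes (∈-combinations _ _ (χ j g) (∣χ∣ j g g-balanced))
                                                   (χ j g ∈ᶠ? combinations (c * d) (s * d))) ⟩
          ∑[ j < c ] 1
        ≡⟨ ∑-const c 1 ⟩
          c * 1
        ∎
        where open ≡-Reasoning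

  #balanced-pos : 1 ≤ #balanced
  #balanced-pos = subst (1 ≤_) (sym (∑ʷ-content≡multinomial (c * d) D))
                        (multinomial-pos (c * d) D (sum-replicate c d))

  upper-bound : ∀ {l} F → Admissible (c * d) (s * d) (suc l) (suc s) (suc (c ∸ s)) F →
    c * length F ≤ l * ((c * d) C (s * d))
  upper-bound {l} F adm = *-cancelʳ-≤ (c * length F) (l * N) H {{H≢0}} (begin
      c * length F * H       ≡⟨ *-assoc c (length F) H ⟩
      c * (length F * H)     ≤⟨ *-monoʳ-≤ c F-bound ⟩
      c * (l * #balanced)    ≡⟨ *-x∙yz≈y∙xz c l #balanced ⟩
      l * (c * #balanced)    ≡⟨ cong (l *_) (sym all-bound) ⟩
      l * (N * H)            ≡⟨ sym (*-assoc l N H) ⟩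
      l * N * H              ∎)
    where
      open ≤-Reasoning
      N H : ℕ
      N = (c * d) C (s * d)
      H = hitsOfSize (s * d)
      F-bound : length F * H ≤ l * #balanced
      F-bound = subst (_≤ l * #balanced) (hitsIn-length F (proj₁ adm) (proj₁ (proj₂ adm)))
                      (hitsIn-admissible≤ F adm)
      all-bound : N * H ≡ c * #balanced
      all-bound = begin-equality
        N * H   ≡⟨ cong (_* H) (sym (length-combinations (c * d) (s * d))) ⟩
        length (combinations (c * d) (s * d)) * H
                ≡⟨ sym (hitsIn-length _ (combinations-unique (c * d) (s * d)) (combinations-size (c * d) (s * d))) ⟩
        hitsIn (combinations (c * d) (s * d))   ≡⟨ hitsIn-combinations ⟩
        c * #balanced ∎
      H≢0 : NonZero H
      H≢0 = ≢-nonZero λ H≡0 → <⇒≢ (*-mono-≤ (>-nonZero⁻¹ c) #balanced-pos)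
                                  (sym (trans (sym all-bound) (trans (cong (N *_) H≡0) (*-zeroʳ N))))

-- Extremal families

IsM-of-optimal : ∀ {n t l k₁ k₂} c .{{_ : NonZero c}} r F₀ → Admissible n t l k₁ k₂ F₀ → c * length F₀ ≡ r →
  (∀ F → Admissible n t l k₁ k₂ F → c * length F ≤ r) → ∃ λ m → IsM n t l k₁ k₂ m × c * m ≡ r
IsM-of-optimal c r F₀ F₀-admissible c|F₀|≡r bound =
  length F₀ ,
  ((F₀ , F₀-admissible , refl) ,
   λ F adm → *-cancelˡ-≤ c (≤-trans (bound F adm) (≤-reflexive (sym c|F₀|≡r)))) ,
  c|F₀|≡r

m[1+s] : ∀ c s d .{{_ : NonZero s}} .{{_ : NonZero d}} → s ≤ c →
  ∃ λ m → IsM (c * d) (s * d) (suc s) (suc s) (suc (c ∸ s)) m × c * m ≡ s * ((c * d) C (s * d))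
m[1+s] c@(suc c′) s@(suc s′) d@(suc d′) s≤c =
  IsM-of-optimal c (s * ((c * d) C (s * d))) (containing₀ n′ t′)
    (containing₀-admissible n′ t′ s (suc (c ∸ s)))
    (trans (cong (c *_) (trans (length-map (true ∷_) (combinations n′ t′)) (length-combinations n′ t′)))
           (c*nCk≡s*[1+n]C[1+k] n′ t′ c s (*-x∙yz≈y∙xz c s d)))
    (upper-bound {s})
  where
    -- c * d and s * d reduce to suc n′ and suc t′
    n′ t′ : ℕ
    n′ = d′ + c′ * d
    t′ = d′ + s′ * d
    open Averaging c s s≤c d

m[1+c∸s] : ∀ c s d .{{_ : NonZero s}} .{{_ : NonZero d}} → s ≤ c →
  ∃ λ m → IsM (c * d) (s * d) (suc (c ∸ s)) (suc s) (suc (c ∸ s)) m × c * m ≡ (c ∸ s) * ((c * d) C (s * d))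
m[1+c∸s] c@(suc c′) s@(suc s′) d@(suc d′) s≤c =
  IsM-of-optimal c ((c ∸ s) * ((c * d) C (s * d))) (avoiding₀ n′ (s * d))
    (avoiding₀-admissible n′ (s * d) (suc s) (c ∸ s))
    (trans (cong (c *_) (trans (length-map (false ∷_) (combinations n′ (s * d)))
                               (length-combinations n′ (s * d))))
           (c*nC[1+k]≡[c∸s]*[1+n]C[1+k] n′ t′ c s (c*nCk≡s*[1+n]C[1+k] n′ t′ c s (*-x∙yz≈y∙xz c s d))))
    (upper-bound {c ∸ s})
  where
    n′ t′ : ℕ
    n′ = d′ + c′ * d
    t′ = d′ + s′ * d
    open Averaging c s s≤c d

corollary5p7 : (n c s d : ℕ) → 2 ≤ n → 2 ≤ c → 1 ≤ s → s < c → n ≡ c * d →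
    (∃ λ m → IsM n (s * d) (suc (s ⊓ (c ∸ s))) (suc s) (suc (c ∸ s)) m
    × c * m ≡ (s ⊓ (c ∸ s)) * (n C (s * d)))
    × (∃ λ m → IsM n (s * d) (suc (c ∸ (s ⊓ (c ∸ s)))) (suc s) (suc (c ∸ s)) m
    × c * m ≡ (c ∸ (s ⊓ (c ∸ s))) * (n C (s * d)))
corollary5p7 .(c * d) c s@(suc _) d@(suc _) _ _ _ s<c refl with s ≤? c ∸ s
... | yes s≤c∸s rewrite m≤n⇒m⊓n≡m s≤c∸s =
  m[1+s] c s d (<⇒≤ s<c) , m[1+c∸s] c s d (<⇒≤ s<c)
... | no s≰c∸s rewrite m≥n⇒m⊓n≡n (<⇒≤ (≰⇒> s≰c∸s)) | m∸[m∸n]≡n (<⇒≤ s<c) =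
  m[1+c∸s] c s d (<⇒≤ s<c) , m[1+s] c s d (<⇒≤ s<c)
corollary5p7 .(c * 0) c _ zero 2≤n _ _ _ refl = contradiction (subst (2 ≤_) (*-zeroʳ c) 2≤n) λ ()
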